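{- Let $G$ be a graph and let $\omega$ and $d$ be integers. Then $G$ has a treecut decomposition of width at most $\omega$ and height at most $d$ if and only if $G$ has a derivation of width at most $\omega$ and length at most $d+1$.
   Context: Graphs are finite, undirected, possibly with multiedges. For $V'\subseteq V(G)$, $\delta_G(V')$ is the multiset of edges with exactly one endpoint in $V'$. Treecut decomposition: a pair $(T,\chi)$ with $T$ a rooted tree and $\chi:V(T)\to 2^{V(G)}$ such that the sets $\chi(t)$ are pairwise disjoint, possibly empty, with union $V(G)$. For $t\in V(T)$, $T_t$ is the subtree rooted at $t$, $V_t=\bigcup_{s\in V(T_t)}\chi(s)$, $\mathrm{ad}(t)=\delta_G(V_t)$, and $\mathrm{tor}(t)=|\chi(t)|+$ (number of neighbours of $t$ in $T$). The width of $(T,\chi)$ is $\max_{t\in V(T)}\max\{|\mathrm{ad}(t)|,\mathrm{tor}(t)\}$. The height $h_T(t)$ of a node $t$ is the number of vertices on the path from the root to $t$ (so the root has height $1$), and the height of $(T,\chi)$ is $\max_t h_T(t)$. Derivation: a weak partition of a set $S$ is a set of pairwise disjoint nonempty subsets of $S$. A derivation of $G$ of length $l$ is a sequence $(P_1,\dots,P_l)$ of weak partitions of $V(G)$ with $P_1=\emptyset$, $P_l=\{V(G)\}$, and, for every $1\le i<l$, $P_i$ refines $P_{i+1}$ (every set of $P_i$ is contained in some set of $P_{i+1}$). For $p\in P_i$, the children of $p$ at level $i$ are the sets $c\in P_{i-1}$ with $c\subseteq p$; let $\mathrm{c}^i(p)$ be the set of these children and $\chi^i(p)=p\setminus\bigcup_{c\in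 \mathrm{c}^i(p)}c$. Let $\mathrm{tor}^i(p)=|\chi^i(p)|+|\mathrm{c}^i(p)|+1$ if $i\ne l$ and $\mathrm{tor}^i(p)=|\chi^i(p)|+|\mathrm{c}^i(p)|$ if $i=l$. The width of $p$ at level $i$ is $\max\{|\delta_G(p)|,\mathrm{tor}^i(p)\}$, and the width of the derivation is the maximum width of $p$ at level $i$ over all $i$ and all $p\in P_i$. -}

module Defs where

open import Data.Nat using (ℕ; zero; suc; _+_; _≤_)
open import Data.Bool using (Bool; true; false; if_then_else_; _xor_)
open import Data.Fin using (Fin; zero; suc; inject₁; fromℕ)
open import Data.Fin.Subset using (Subset; ⋃; ∣_∣; _∩_; _─_; _⊆_; ⊤; Empty; Nonempty)
open import Data.Fin.Subset.Properties using (_⊆?_)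
open import Data.Vec using (lookup)
open import Data.List using (List; []; _∷_; [_]; length; filter; map; _++_)
open import Data.Nat.ListAction using (sum)
open import Relation.Nullary.Decidable using (⌊_⌋)
import Data.Unit
open import Data.List.Relation.Unary.All using (All)
open import Data.List.Relation.Unary.Any using (Any)
open import Data.List.Relation.Unary.AllPairs using (AllPairs)
open import Data.Product using (_×_; _,_; Σ)
open import Data.Integer as ℤ using (ℤ; +_)
open import Relation.Binary.PropositionalEquality using (_≡_)

record Graph : Set where
  constructor graph
  field
    n     : ℕ
    edges : List (Fin n × Fin n)
open Graph public

cutSize : (G : Graph) → Subset (n G) → ℕ
cutSize G S = sum (map (λ e → if lookup S (Data.Product.proj₁ e) xor lookup S (Data.Product.proj₂ e)
                                then 1 else 0) (edges G))

data Tree (A : Set) : Set where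
  node : A → List (Tree A) → Tree A

mutual
  labels : ∀ {A} → Tree A → List A
  labels (node a ts) = a ∷ labelsF ts

  labelsF : ∀ {A} → List (Tree A) → List A
  labelsF []       = []
  labelsF (t ∷ ts) = labels t ++ labelsF ts

mutual
  -- height: number of vertices on the longest root-to-node path
  height : ∀ {A} → Tree A → ℕ
  height (node _ ts) = suc (heightF ts)

  heightF : ∀ {A} → List (Tree A) → ℕ
  heightF []       = 0
  heightF (t ∷ ts) = height t Data.Nat.⊔ heightF ts

IsTreecutDecomposition : (G : Graph) → Tree (Subset (n G)) → Set
IsTreecutDecomposition G T =
  AllPairs (λ A B → Empty (A ∩ B)) (labels T) × ⋃ (labels T) ≡ ⊤

mutual
  -- every node t has |ad(t)| ≤ ω and tor(t) ≤ ω, where for a non-root node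
  -- the number of tree neighbours is (#children + 1) and for the root it is #children
  NodesWidth≤ : (G : Graph) (ω : ℤ) (isRoot : Bool) → Tree (Subset (n G)) → Set
  NodesWidth≤ G ω isRoot (node χ ts) =
      (+ cutSize G (⋃ (labels (node χ ts))) ℤ.≤ ω)
    × (+ (∣ χ ∣ + length ts + (if isRoot then 0 else 1)) ℤ.≤ ω)
    × NodesWidthF≤ G ω ts

  NodesWidthF≤ : (G : Graph) (ω : ℤ) → List (Tree (Subset (n G))) → Set
  NodesWidthF≤ G ω []       = Data.Unit.⊤
  NodesWidthF≤ G ω (t ∷ ts) = NodesWidth≤ G ω false t × NodesWidthF≤ G ω ts

HasTreecutDecomposition : (G : Graph) (ω d : ℤ) → Set
HasTreecutDecomposition G ω d =
  Σ (Tree (Subset (n G))) λ T →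
    IsTreecutDecomposition G T × NodesWidth≤ G ω true T × (+ height T ℤ.≤ d)

IsWeakPartition : ∀ {m} → List (Subset m) → Set
IsWeakPartition P = All Nonempty P × AllPairs (λ A B → Empty (A ∩ B)) P

Refines : ∀ {m} → List (Subset m) → List (Subset m) → Set
Refines P Q = All (λ p → Any (p ⊆_) Q) P

-- A derivation of length l = suc k; level i (1 ≤ i ≤ l) of the paper is
-- index i-1 : Fin (suc k) here.
record Derivation (G : Graph) : Set where
  field
    k     : ℕ
    P     : Fin (suc k) → List (Subset (n G))
    weak  : ∀ i → IsWeakPartition (P i)
    first : P zero ≡ []
    last  : P (fromℕ k) ≡ [ ⊤ ]
    refines : ∀ (i : Fin k) → Refines (P (inject₁ i)) (P (suc i))

  len : ℕ
  len = suc k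

  children : Fin (suc k) → Subset (n G) → List (Subset (n G))
  children zero    p = []
  children (suc i) p = filter (λ c → c ⊆? p) (P (inject₁ i))

  chi : Fin (suc k) → Subset (n G) → Subset (n G)
  chi i p = p ─ ⋃ (children i p)

  isLast : Fin (suc k) → Bool
  isLast i = ⌊ Data.Fin._≟_ i (fromℕ k) ⌋

  tor : Fin (suc k) → Subset (n G) → ℕ
  tor i p = ∣ chi i p ∣ + length (children i p) + (if isLast i then 0 else 1)

  Width≤ : ℤ → Set
  Width≤ ω = ∀ i → All (λ p → (+ cutSize G p ℤ.≤ ω) × (+ tor i p ℤ.≤ ω)) (P i)

HasDerivation : (G : Graph) (ω d : ℤ) → Set
HasDerivation G ω d =
  Σ (Derivation G) λ D → Derivation.Width≤ D ω × (+ Derivation.len D ℤ.≤ d ℤ.+ + 1)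

-- A derivation and a treecut decomposition describe the same laminar family of vertex sets.
-- Given a derivation, every set p of level i + 1 becomes a node whose children are the sets of
-- level i inside p and whose bag is the part of p they leave uncovered. As the levels are weak
-- partitions, the bags partition V(G), the vertex set below the node is p itself, and adhesion and
-- torso of the node are |δ(p)| and tor(p); since P₁ = ∅ the tree has height at most l − 1.
-- Conversely, level i of the derivation is the list of nonempty vertex sets V_t of the nodes t at
-- depth h(T) + 1 − i. The V_t of one depth are pairwise disjoint, so the children of V_t in the
-- derivation are exactly the nonempty V_c of the children c of t, and V_t minus their union lies
-- in χ(t); hence the torso can only shrink.

module Submission where

open import Defs
open import Data.Bool using (Bool; true; false; if_then_else_)
open import Data.Empty using (⊥-elim)
open import Data.Fin using (Fin; zero; suc; inject₁; fromℕ; toℕ; fromℕ<; _≟_)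
import Data.Fin.Properties as FinP
open import Data.Fin.Subset
  using (Subset; ⋃; ∣_∣; _∩_; _∪_; _─_; _⊆_; ⊤; Empty; Nonempty; _∈_; _∉_; outside)
open import Data.Fin.Subset.Properties
  using (_⊆?_; nonempty?; _∈?_; x∈p∪q⁻; x∈p∩q⁺; x∈p∩q⁻; ∉⊥; ∈⊤; ⊆-refl; ⊆-min; ⊆-antisym;
         p⊆q⇒∣p∣≤∣q∣; p─q⊆p; x∈p∧x∉q⇒x∈p─q; p⊆p∪q; q⊆p∪q; ∪-assoc; ∪-identityˡ)
open import Data.Integer as ℤ using (ℤ; +_)
import Data.Integer.Properties as ℤP
open import Data.List using (List; []; _∷_; [_]; length; filter; map; _++_; concatMap)
open import Data.List.Properties
  using (map-cong; map-∘; map-id; map-++; filter-++; filter-all; filter-none; filter-accept;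
         length-map; length-filter; ++-identityʳ)
open import Data.List.Relation.Unary.All as All using (All; []; _∷_)
import Data.List.Relation.Unary.All.Properties as AllP
open import Data.List.Relation.Unary.Any using (Any; here; there)
import Data.List.Relation.Unary.Any.Properties as AnyP
open import Data.List.Relation.Unary.AllPairs as AllPairs using (AllPairs; []; _∷_)
import Data.List.Relation.Unary.AllPairs.Properties as AllPairsP
open import Data.Nat as ℕ using (ℕ; zero; suc; _+_; _∸_; _≤_; _<_; _≡ᵇ_; z≤n; s≤s)
import Data.Nat.Properties as ℕP
open import Data.Product using (_×_; _,_; proj₁; proj₂)
open import Data.Sum as Sum using (inj₁; inj₂)
open import Data.Unit using (tt)
open import Data.Vec using (_∷_; here; there)
open import Function.Base using (_∘_; _on_)
open import Function.Bundles using (_⇔_; mk⇔)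
open import Relation.Nullary using (¬_; yes; no)
open import Relation.Nullary.Decidable using (⌊_⌋; ⌊⌋-map′)
open import Relation.Binary.PropositionalEquality
  using (_≡_; refl; sym; trans; cong; cong₂; subst; subst₂; module ≡-Reasoning)

AllPairs-++⁻ : ∀ {A : Set} {R : A → A → Set} xs {ys} → AllPairs R (xs ++ ys) →
               AllPairs R xs × AllPairs R ys × All (λ x → All (R x) ys) xs
AllPairs-++⁻ [] rs = [] , rs , []
AllPairs-++⁻ (x ∷ xs) (rx ∷ rs) with AllPairs-++⁻ xs rs | AllP.++⁻ xs rx
... | rxs , rys , rxsys | rxxs , rxys = (rxxs ∷ rxs) , rys , (rxys ∷ rxsys)

x∈p─q⇒x∉q : ∀ {m} (p q : Subset m) {x} → x ∈ p ─ q → x ∉ q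
x∈p─q⇒x∉q (_ ∷ p) (outside ∷ q) here ()
x∈p─q⇒x∉q (_ ∷ p) (_ ∷ q) (there x∈p─q) (there x∈q) = x∈p─q⇒x∉q p q x∈p─q x∈q

module _ {m : ℕ} where

  Disjoint : Subset m → Subset m → Set
  Disjoint p q = Empty (p ∩ q)

  disjoint : ∀ {p q} → (∀ {x} → x ∈ p → x ∉ q) → Disjoint p q
  disjoint {p} {q} f (_ , x∈p∩q) = let x∈p , x∈q = x∈p∩q⁻ p q x∈p∩q in f x∈p x∈q

  Disjoint⇒∉ : ∀ {p q x} → Disjoint p q → x ∈ p → x ∉ q
  Disjoint⇒∉ d x∈p x∈q = d (_ , x∈p∩q⁺ (x∈p , x∈q))

  Disjoint-sym : ∀ {p q} → Disjoint p q → Disjoint q p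
  Disjoint-sym d = disjoint λ x∈q x∈p → Disjoint⇒∉ d x∈p x∈q

  Disjoint-mono : ∀ {p p′ q q′} → p ⊆ p′ → q ⊆ q′ → Disjoint p′ q′ → Disjoint p q
  Disjoint-mono p⊆p′ q⊆q′ d = disjoint λ x∈p x∈q → Disjoint⇒∉ d (p⊆p′ x∈p) (q⊆q′ x∈q)

  Disjoint-∪ʳ : ∀ {p q r} → Disjoint p q → Disjoint p r → Disjoint p (q ∪ r)
  Disjoint-∪ʳ {q = q} {r} d e =
    disjoint λ x∈p x∈q∪r → Sum.[ Disjoint⇒∉ d x∈p , Disjoint⇒∉ e x∈p ] (x∈p∪q⁻ q r x∈q∪r)

  Disjoint-─ : ∀ (p q : Subset m) → Disjoint (p ─ q) q
  Disjoint-─ p q = disjoint (x∈p─q⇒x∉q p q)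

  p─q∪q≡p : ∀ {p q : Subset m} → q ⊆ p → (p ─ q) ∪ q ≡ p
  p─q∪q≡p {p} {q} q⊆p = ⊆-antisym (λ x∈ → Sum.[ p─q⊆p p q , q⊆p ] (x∈p∪q⁻ (p ─ q) q x∈)) ⊇
    where
    ⊇ : p ⊆ (p ─ q) ∪ q
    ⊇ {x} x∈p with x ∈? q
    ... | yes x∈q = q⊆p∪q (p ─ q) q x∈q
    ... | no  x∉q = p⊆p∪q q (x∈p∧x∉q⇒x∈p─q x∈p x∉q)

  ⋃-++ : ∀ (ps qs : List (Subset m)) → ⋃ (ps ++ qs) ≡ ⋃ ps ∪ ⋃ qs
  ⋃-++ []       qs = sym (∪-identityˡ (⋃ qs))
  ⋃-++ (p ∷ ps) qs = trans (cong (p ∪_) (⋃-++ ps qs)) (sym (∪-assoc p (⋃ ps) (⋃ qs)))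

  ⊆-⋃ : ∀ (ps : List (Subset m)) → All (_⊆ ⋃ ps) ps
  ⊆-⋃ []       = []
  ⊆-⋃ (p ∷ ps) = p⊆p∪q (⋃ ps) ∷ All.map (λ q⊆ {_} x∈q → q⊆p∪q p (⋃ ps) (q⊆ x∈q)) (⊆-⋃ ps)

  ⋃-⊆ : ∀ {p} {qs : List (Subset m)} → All (_⊆ p) qs → ⋃ qs ⊆ p
  ⋃-⊆ []                         x∈⊥ = ⊥-elim (∉⊥ x∈⊥)
  ⋃-⊆ {qs = q ∷ qs} (q⊆p ∷ qs⊆p) x∈  = Sum.[ q⊆p , ⋃-⊆ qs⊆p ] (x∈p∪q⁻ q (⋃ qs) x∈)

  Disjoint-⋃ʳ⁺ : ∀ {p} {qs : List (Subset m)} → All (Disjoint p) qs → Disjoint p (⋃ qs)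
  Disjoint-⋃ʳ⁺ []       = disjoint λ _ → ∉⊥
  Disjoint-⋃ʳ⁺ (d ∷ ds) = Disjoint-∪ʳ d (Disjoint-⋃ʳ⁺ ds)

  Disjoint-⋃ʳ⁻ : ∀ {p} (qs : List (Subset m)) → Disjoint p (⋃ qs) → All (Disjoint p) qs
  Disjoint-⋃ʳ⁻ []       _ = []
  Disjoint-⋃ʳ⁻ (q ∷ qs) d = Disjoint-mono ⊆-refl (p⊆p∪q (⋃ qs)) d
                          ∷ Disjoint-⋃ʳ⁻ qs (Disjoint-mono ⊆-refl (q⊆p∪q q (⋃ qs)) d)

  Disjoint-⋃⁺ : ∀ {ps qs : List (Subset m)} → All (λ p → All (Disjoint p) qs) ps →
                Disjoint (⋃ ps) (⋃ qs)
  Disjoint-⋃⁺ dss = Disjoint-sym (Disjoint-⋃ʳ⁺ (All.map (Disjoint-sym ∘ Disjoint-⋃ʳ⁺) dss))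

  Disjoint-⋃⁻ : ∀ (ps qs : List (Subset m)) → Disjoint (⋃ ps) (⋃ qs) →
                All (λ p → All (Disjoint p) qs) ps
  Disjoint-⋃⁻ ps qs d = All.map (Disjoint-⋃ʳ⁻ qs ∘ Disjoint-sym) (Disjoint-⋃ʳ⁻ ps (Disjoint-sym d))

  filter-nonempty⁺ : ∀ {P : Subset m → Set} {ps} → All (λ p → Nonempty p → P p) ps →
                     All P (filter nonempty? ps)
  filter-nonempty⁺ {ps = ps} fs =
    All.zipWith (λ (f , ne) → f ne) (AllP.filter⁺ nonempty? fs , AllP.all-filter nonempty? ps)

  Any-filter-nonempty : ∀ {P : Subset m → Set} {ps} → (∀ {p} → P p → Nonempty p) →
                        Any P ps → Any P (filter nonempty? ps)
  Any-filter-nonempty ne a with AnyP.filter⁺ nonempty? a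
  ... | inj₁ a′  = a′
  ... | inj₂ ¬ne = ⊥-elim (¬ne (ne (AnyP.lookup-result a)))

subtrees : ∀ {A : Set} → Tree A → List (Tree A)
subtrees (node _ ts) = ts

heightF-lub : ∀ {A : Set} {h} (ts : List (Tree A)) → All (λ t → height t ≤ h) ts → heightF ts ≤ h
heightF-lub []       []       = z≤n
heightF-lub (t ∷ ts) (h ∷ hs) = ℕP.⊔-lub h (heightF-lub ts hs)

height-subtrees : ∀ {A : Set} (t : Tree A) → All (λ c → height c < height t) (subtrees t)
height-subtrees (node _ ts) = All.map s≤s (heightF-ub ts)
  where
  heightF-ub : ∀ ts → All (λ t → height t ≤ heightF ts) ts
  heightF-ub []       = []
  heightF-ub (t ∷ ts) = ℕP.m≤m⊔n (height t) (heightF ts)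
                      ∷ All.map (λ h → ℕP.≤-trans h (ℕP.m≤n⊔m (height t) (heightF ts))) (heightF-ub ts)

nextLevel : ∀ {A : Set} → List (Tree A) → List (Tree A)
nextLevel = concatMap subtrees

level : ∀ {A : Set} → Tree A → ℕ → List (Tree A)
level t zero    = [ t ]
level t (suc j) = nextLevel (level t j)

All-nextLevel : ∀ {A : Set} {P : Tree A → Set} {ts} →
                All (All P ∘ subtrees) ts → All P (nextLevel ts)
All-nextLevel = AllP.concat⁺ ∘ AllP.map⁺

level-height : ∀ {A : Set} (t : Tree A) j → All (λ s → j + height s ≤ height t) (level t j)
level-height t zero    = ℕP.≤-refl ∷ []
level-height t (suc j) = All-nextLevel (All.map deeper (level-height t j))
  where
  deeper : ∀ {s} → j + height s ≤ height t → All (λ c → suc j + height c ≤ height t) (subtrees s)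
  deeper {s} s≤ = All.map (λ {c} c<s → ℕP.≤-trans (step c c<s) s≤) (height-subtrees s)
    where
    step : ∀ c → height c < height s → suc j + height c ≤ j + height s
    step c c<s = ℕP.≤-trans (ℕP.≤-reflexive (sym (ℕP.+-suc j (height c)))) (ℕP.+-monoʳ-≤ j c<s)

level-height≡[] : ∀ {A : Set} (t : Tree A) → level t (height t) ≡ []
level-height≡[] t with level t (height t) | level-height t (height t)
... | []           | _       = refl
... | node _ _ ∷ _ | s≤ ∷ _ = ⊥-elim (ℕP.m+1+n≰m (height t) s≤)

module _ {m : ℕ} where

  vertices : Tree (Subset m) → Subset m
  vertices t = ⋃ (labels t)

  DisjointBags : Tree (Subset m) → Set
  DisjointBags t = AllPairs Disjoint (labels t)

  ⋃-labelsF : ∀ ts → ⋃ (labelsF ts) ≡ ⋃ (map vertices ts)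
  ⋃-labelsF []       = refl
  ⋃-labelsF (t ∷ ts) = trans (⋃-++ (labels t) (labelsF ts)) (cong (vertices t ∪_) (⋃-labelsF ts))

  vertices-node : ∀ χ ts → vertices (node χ ts) ≡ χ ∪ ⋃ (map vertices ts)
  vertices-node χ ts = cong (χ ∪_) (⋃-labelsF ts)

  vertices-subtrees⊆ : ∀ t → All (λ c → vertices c ⊆ vertices t) (subtrees t)
  vertices-subtrees⊆ (node χ ts) = AllP.map⁻ (All.map lift (⊆-⋃ (map vertices ts)))
    where
    lift : ∀ {p} → p ⊆ ⋃ (map vertices ts) → p ⊆ vertices (node χ ts)
    lift p⊆ x∈p = subst (_ ∈_) (sym (vertices-node χ ts)) (q⊆p∪q χ _ (p⊆ x∈p))

  subtrees-Disjointˡ : ∀ {s q} → Disjoint (vertices s) q →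
                       All (λ c → Disjoint (vertices c) q) (subtrees s)
  subtrees-Disjointˡ {s} {q} d = All.map (λ {c} → shrink {c}) (vertices-subtrees⊆ s)
    where
    shrink : ∀ {c} → vertices c ⊆ vertices s → Disjoint (vertices c) q
    shrink c⊆ = Disjoint-mono c⊆ ⊆-refl d

  subtrees-Disjointʳ : ∀ {p s} → Disjoint p (vertices s) →
                       All (λ c → Disjoint p (vertices c)) (subtrees s)
  subtrees-Disjointʳ {p} {s} d = All.map (λ {c} → shrink {c}) (vertices-subtrees⊆ s)
    where
    shrink : ∀ {c} → vertices c ⊆ vertices s → Disjoint p (vertices c)
    shrink c⊆ = Disjoint-mono ⊆-refl c⊆ d

  labelsF-disjoint⁺ : ∀ {ts} → AllPairs (Disjoint on vertices) ts → All DisjointBags ts →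
                      AllPairs Disjoint (labelsF ts)
  labelsF-disjoint⁺ {[]}     []       []       = []
  labelsF-disjoint⁺ {t ∷ ts} (d ∷ ds) (i ∷ is) =
    AllPairsP.++⁺ i (labelsF-disjoint⁺ ds is) (Disjoint-⋃⁻ (labels t) (labelsF ts) t⊥ts)
    where
    t⊥ts : Disjoint (vertices t) (⋃ (labelsF ts))
    t⊥ts = subst (Disjoint (vertices t)) (sym (⋃-labelsF ts)) (Disjoint-⋃ʳ⁺ (AllP.map⁺ d))

  labelsF-disjoint⁻ : ∀ ts → AllPairs Disjoint (labelsF ts) →
                      AllPairs (Disjoint on vertices) ts × All DisjointBags ts
  labelsF-disjoint⁻ []       _ = [] , []
  labelsF-disjoint⁻ (t ∷ ts) h with AllPairs-++⁻ (labels t) h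
  ... | i , rest , cross with labelsF-disjoint⁻ ts rest
  ... | ds , is = (AllP.map⁻ (Disjoint-⋃ʳ⁻ (map vertices ts) t⊥ts) ∷ ds) , (i ∷ is)
    where
    t⊥ts : Disjoint (vertices t) (⋃ (map vertices ts))
    t⊥ts = subst (Disjoint (vertices t)) (⋃-labelsF ts) (Disjoint-⋃⁺ cross)

  subtrees-disjoint : ∀ t → DisjointBags t →
                      AllPairs (Disjoint on vertices) (subtrees t) × All DisjointBags (subtrees t)
  subtrees-disjoint (node χ ts) (_ ∷ h) = labelsF-disjoint⁻ ts h

module _ (G : Graph) (ω : ℤ) where

  All⇒NodesWidthF≤ : ∀ {ts} → All (NodesWidth≤ G ω false) ts → NodesWidthF≤ G ω ts
  All⇒NodesWidthF≤ []       = tt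
  All⇒NodesWidthF≤ (w ∷ ws) = w , All⇒NodesWidthF≤ ws

  NodesWidthF≤⇒All : ∀ ts → NodesWidthF≤ G ω ts → All (NodesWidth≤ G ω false) ts
  NodesWidthF≤⇒All []       _        = []
  NodesWidthF≤⇒All (t ∷ ts) (w , ws) = w ∷ NodesWidthF≤⇒All ts ws

  subtrees-width : ∀ {root} t → NodesWidth≤ G ω root t → All (NodesWidth≤ G ω false) (subtrees t)
  subtrees-width (node _ ts) (_ , _ , ws) = NodesWidthF≤⇒All ts ws

  -- The width bound of a set p with children cs, shared by the sets of a derivation and the vertex
  -- sets of decomposition nodes; top marks the last level, resp. the root, which has no parent edge.
  SetWidth≤ : List (Subset (n G)) → Bool → Subset (n G) → Set
  SetWidth≤ cs top p = (+ cutSize G p ℤ.≤ ω)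
                     × (+ (∣ p ─ ⋃ cs ∣ + length cs + (if top then 0 else 1)) ℤ.≤ ω)

+[1+a]≤d+1⇒+a≤d : ∀ a d → + suc a ℤ.≤ d ℤ.+ + 1 → + a ℤ.≤ d
+[1+a]≤d+1⇒+a≤d a d h = subst (+ a ℤ.≤_) d+1-1≡d (ℤP.+-monoˡ-≤ (ℤ.- + 1) h)
  where
  open ≡-Reasoning
  d+1-1≡d : d ℤ.+ + 1 ℤ.+ ℤ.- + 1 ≡ d
  d+1-1≡d = begin
    d ℤ.+ + 1 ℤ.+ ℤ.- + 1   ≡⟨ ℤP.+-assoc d (+ 1) (ℤ.- + 1) ⟩
    d ℤ.+ (+ 1 ℤ.+ ℤ.- + 1) ≡⟨ cong (λ z → d ℤ.+ z) (ℤP.+-inverseʳ (+ 1)) ⟩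
    d ℤ.+ + 0               ≡⟨ ℤP.+-identityʳ d ⟩
    d                       ∎

+a≤d⇒+[1+a]≤d+1 : ∀ a d → + a ℤ.≤ d → + suc a ℤ.≤ d ℤ.+ + 1
+a≤d⇒+[1+a]≤d+1 a d h = subst (λ b → + b ℤ.≤ d ℤ.+ + 1) (ℕP.+-comm a 1) (ℤP.+-monoˡ-≤ (+ 1) h)

isLast : ∀ {k} → Fin (suc k) → Bool
isLast {k} i = ⌊ i ≟ fromℕ k ⌋

∸-fromℕ : ∀ k → k ∸ toℕ (fromℕ k) ≡ 0
∸-fromℕ zero    = refl
∸-fromℕ (suc k) = ∸-fromℕ k

∸-inject₁ : ∀ {k} (i : Fin k) → k ∸ toℕ (inject₁ i) ≡ suc (k ∸ toℕ (suc i))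
∸-inject₁ {suc k} zero    = refl
∸-inject₁ {suc k} (suc i) = ∸-inject₁ i

isLast-∸ : ∀ {k} (i : Fin (suc k)) → isLast i ≡ (k ∸ toℕ i ≡ᵇ 0)
isLast-∸ {zero}  zero    = refl
isLast-∸ {suc k} zero    = refl
isLast-∸ {suc k} (suc i) = trans (⌊⌋-map′ _ _ (i ≟ fromℕ k)) (isLast-∸ i)

isLast-fromℕ : ∀ k → isLast (fromℕ k) ≡ true
isLast-fromℕ k = trans (isLast-∸ (fromℕ k)) (cong (_≡ᵇ 0) (∸-fromℕ k))

isLast-inject₁ : ∀ {k} (i : Fin k) → isLast (inject₁ i) ≡ false
isLast-inject₁ i = trans (isLast-∸ (inject₁ i)) (cong (_≡ᵇ 0) (∸-inject₁ i))

-- From derivations to treecut decompositions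

module _ {m : ℕ} where

  childrenIn : List (Subset m) → Subset m → List (Subset m)
  childrenIn ps p = filter (_⊆? p) ps

  childrenAt : ∀ {k} → (Fin (suc k) → List (Subset m)) → Fin (suc k) → Subset m → List (Subset m)
  childrenAt P zero    p = []
  childrenAt P (suc i) p = childrenIn (P (inject₁ i)) p

  childrenAt-inject₁ : ∀ {k} (P : Fin (suc (suc k)) → List (Subset m)) i p →
                       childrenAt (P ∘ inject₁) i p ≡ childrenAt P (inject₁ i) p
  childrenAt-inject₁ P zero    p = refl
  childrenAt-inject₁ P (suc i) p = refl

  -- The subtree of p at level i; the levels below i are P ∘ inject₁, which makes the recursion
  -- structural in i.
  toTree : ∀ {k} → (Fin (suc k) → List (Subset m)) → Fin (suc k) → Subset m → Tree (Subset m)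
  toTree P zero p = node (p ─ ⋃ []) []
  toTree {suc k} P (suc i) p =
    let cs = childrenIn (P (inject₁ i)) p in node (p ─ ⋃ cs) (map (toTree (P ∘ inject₁) i) cs)

  mutual
    vertices-toTree : ∀ {k} P (i : Fin (suc k)) p → vertices (toTree P i p) ≡ p
    vertices-toTree P zero p = p─q∪q≡p (⊆-min p)
    vertices-toTree {suc k} P (suc i) p = begin
      vertices (node (p ─ ⋃ cs) forest)     ≡⟨ vertices-node (p ─ ⋃ cs) forest ⟩
      (p ─ ⋃ cs) ∪ ⋃ (map vertices forest) ≡⟨ cong (((p ─ ⋃ cs) ∪_) ∘ ⋃) (vertices-forest P′ i cs) ⟩
      (p ─ ⋃ cs) ∪ ⋃ cs                    ≡⟨ p─q∪q≡p (⋃-⊆ (AllP.all-filter (_⊆? p) (P (inject₁ i)))) ⟩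
      p                                    ∎
      where
      open ≡-Reasoning
      P′ = P ∘ inject₁
      cs = childrenIn (P (inject₁ i)) p
      forest = map (toTree P′ i) cs

    vertices-forest : ∀ {k} P (i : Fin (suc k)) cs → map vertices (map (toTree P i) cs) ≡ cs
    vertices-forest P i cs =
      trans (sym (map-∘ cs)) (trans (map-cong (vertices-toTree P i) cs) (map-id cs))

  toTree-disjoint : ∀ {k} (P : Fin (suc k) → List (Subset m)) → (∀ j → AllPairs Disjoint (P j)) →
                    ∀ i p → DisjointBags (toTree P i p)
  toTree-disjoint P _ zero p = [] ∷ []
  toTree-disjoint {suc k} P disj (suc i) p =
      Disjoint-⋃ʳ⁻ (labelsF forest) bag⊥forest
    ∷ labelsF-disjoint⁺ (AllPairsP.map⁺ (AllPairs.map relabel children-disjoint))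
                        (AllP.map⁺ (All.tabulate λ {c} _ → toTree-disjoint P′ (disj ∘ inject₁) i c))
    where
    P′ = P ∘ inject₁
    cs = childrenIn (P (inject₁ i)) p
    forest = map (toTree P′ i) cs
    children-disjoint : AllPairs Disjoint cs
    children-disjoint = AllPairsP.filter⁺ (_⊆? p) (disj (inject₁ i))
    bag⊥forest : Disjoint (p ─ ⋃ cs) (⋃ (labelsF forest))
    bag⊥forest = subst (Disjoint (p ─ ⋃ cs))
                       (sym (trans (⋃-labelsF forest) (cong ⋃ (vertices-forest P′ i cs))))
                       (Disjoint-─ p (⋃ cs))
    relabel : ∀ {c c′} → Disjoint c c′ → (Disjoint on vertices) (toTree P′ i c) (toTree P′ i c′)
    relabel {c} {c′} = subst₂ Disjoint (sym (vertices-toTree P′ i c)) (sym (vertices-toTree P′ i c′))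

  height-toTree : ∀ {k} (P : Fin (suc k) → List (Subset m)) → P zero ≡ [] →
                  ∀ (i : Fin k) p → height (toTree P (suc i) p) ≤ toℕ (suc i)
  height-toTree P empty zero p rewrite empty = s≤s z≤n
  height-toTree {suc k} P empty (suc i) p =
    s≤s (heightF-lub forest (AllP.map⁺ (All.tabulate λ {c} _ → height-toTree (P ∘ inject₁) empty i c)))
    where
    forest = map (toTree (P ∘ inject₁) (suc i)) (childrenIn (P (inject₁ (suc i))) p)

module _ (G : Graph) (ω : ℤ) where

  LowerLevelsWidth≤ : ∀ {k} → (Fin (suc k) → List (Subset (n G))) → Set
  LowerLevelsWidth≤ {k} P =
    ∀ (j : Fin k) → All (λ p → SetWidth≤ G ω (childrenAt P (inject₁ j) p) false p) (P (inject₁ j))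

  LowerLevelsWidth≤-inject₁ : ∀ {k} (P : Fin (suc (suc k)) → List (Subset (n G))) →
                              LowerLevelsWidth≤ P → LowerLevelsWidth≤ (P ∘ inject₁)
  LowerLevelsWidth≤-inject₁ P lower j = All.map (λ {p} → restrict p) (lower (inject₁ j))
    where
    restrict : ∀ p → SetWidth≤ G ω (childrenAt P (inject₁ (inject₁ j)) p) false p →
               SetWidth≤ G ω (childrenAt (P ∘ inject₁) (inject₁ j) p) false p
    restrict p = subst (λ cs → SetWidth≤ G ω cs false p) (sym (childrenAt-inject₁ P (inject₁ j) p))

  toTree-width : ∀ {k} (P : Fin (suc k) → List (Subset (n G))) → LowerLevelsWidth≤ P → ∀ top i p →
                 SetWidth≤ G ω (childrenAt P i p) top p → NodesWidth≤ G ω top (toTree P i p)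
  toTree-width P _ top zero p (cut , tor) =
    subst (λ q → + cutSize G q ℤ.≤ ω) (sym (vertices-toTree P zero p)) cut , tor , tt
  toTree-width {suc k} P lower top (suc i) p (cut , tor) =
      subst (λ q → + cutSize G q ℤ.≤ ω) (sym (vertices-toTree P (suc i) p)) cut
    , subst (λ l → + (∣ p ─ ⋃ cs ∣ + l + _) ℤ.≤ ω) (sym (length-map (toTree P′ i) cs)) tor
    , All⇒NodesWidthF≤ G ω (AllP.map⁺ (All.map subtree-width (AllP.filter⁺ (_⊆? p) (lower i))))
    where
    P′ = P ∘ inject₁
    cs = childrenIn (P (inject₁ i)) p
    subtree-width : ∀ {c} → SetWidth≤ G ω (childrenAt P (inject₁ i) c) false c →
                    NodesWidth≤ G ω false (toTree P′ i c)
    subtree-width {c} w = toTree-width P′ (LowerLevelsWidth≤-inject₁ P lower) false i c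
                            (subst (λ cs → SetWidth≤ G ω cs false c) (sym (childrenAt-inject₁ P i c)) w)

  derivation-width : (D : Derivation G) → Derivation.Width≤ D ω → ∀ i →
    All (λ p → SetWidth≤ G ω (childrenAt (Derivation.P D) i p) (isLast i) p) (Derivation.P D i)
  derivation-width D W zero    = W zero
  derivation-width D W (suc i) = W (suc i)

  derivation⇒treecut : ∀ d → HasDerivation G ω d → HasTreecutDecomposition G ω d
  derivation⇒treecut d (record { k = zero ; first = first ; last = last } , _)
    with trans (sym first) last
  ... | ()
  derivation⇒treecut d
    (D@record { k = suc k ; P = P ; weak = weak ; first = first ; last = last } , W , len) =
      toTree P top ⊤
    , (toTree-disjoint P (proj₂ ∘ weak) top ⊤ , vertices-toTree P top ⊤)
    , toTree-width P lower true top ⊤ rootWidth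
    , ℤP.≤-trans (ℤ.+≤+ height≤) (+[1+a]≤d+1⇒+a≤d (suc k) d len)
    where
    top = fromℕ (suc k)
    widths = derivation-width D W
    lower : LowerLevelsWidth≤ P
    lower j = subst (λ b → All (λ p → SetWidth≤ G ω (childrenAt P (inject₁ j) p) b p) (P (inject₁ j)))
                    (isLast-inject₁ j) (widths (inject₁ j))
    rootWidth : SetWidth≤ G ω (childrenAt P top ⊤) true ⊤
    rootWidth with subst₂ (λ b ps → All (λ p → SetWidth≤ G ω (childrenAt P top p) b p) ps)
                          (isLast-fromℕ (suc k)) last (widths top)
    ... | w ∷ [] = w
    height≤ : height (toTree P top ⊤) ≤ suc k
    height≤ = subst (λ h → height (toTree P top ⊤) ≤ suc h) (FinP.toℕ-fromℕ k)
                    (height-toTree P first (fromℕ k) ⊤)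

-- From treecut decompositions to derivations

module _ {m : ℕ} where

  nonemptyVertices : List (Tree (Subset m)) → List (Subset m)
  nonemptyVertices ts = filter nonempty? (map vertices ts)

  nextLevel-disjoint : ∀ {ss : List (Tree (Subset m))} →
    AllPairs (Disjoint on vertices) ss → All DisjointBags ss →
    AllPairs (Disjoint on vertices) (nextLevel ss) × All DisjointBags (nextLevel ss)
  nextLevel-disjoint {ss} ds is =
      AllPairsP.concat⁺ {xss = map subtrees ss} (AllP.map⁺ (All.map proj₁ inner))
                        (AllPairsP.map⁺ (AllPairs.map (λ {s} {s′} → across {s} {s′}) ds))
    , All-nextLevel (All.map proj₂ inner)
    where
    inner : All (λ s → AllPairs (Disjoint on vertices) (subtrees s) × All DisjointBags (subtrees s)) ss
    inner = All.map (λ {s} → subtrees-disjoint s) is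
    across : ∀ {s s′} → Disjoint (vertices s) (vertices s′) →
             All (λ c → All ((Disjoint on vertices) c) (subtrees s′)) (subtrees s)
    across {s} {s′} d = All.map (λ {c} → subtrees-Disjointʳ {s = s′}) (subtrees-Disjointˡ {s = s} d)

  level-disjoint : ∀ {t} → DisjointBags t → ∀ j →
                   AllPairs (Disjoint on vertices) (level t j) × All DisjointBags (level t j)
  level-disjoint h zero    = ([] ∷ []) , (h ∷ [])
  level-disjoint h (suc j) = let ds , is = level-disjoint h j in nextLevel-disjoint ds is

  nextLevel-parent : ∀ (ss : List (Tree (Subset m))) →
                     All (λ c → Any (λ s → vertices c ⊆ vertices s) ss) (nextLevel ss)
  nextLevel-parent []       = []
  nextLevel-parent (s ∷ ss) =
    AllP.++⁺ {xs = subtrees s} (All.map here (vertices-subtrees⊆ s))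
                               (All.map there (nextLevel-parent ss))

  nextLevel-refines : ∀ (ss : List (Tree (Subset m))) →
                      Refines (nonemptyVertices (nextLevel ss)) (nonemptyVertices ss)
  nextLevel-refines ss =
    filter-nonempty⁺ (AllP.map⁺ {f = vertices} (All.map (λ {c} → inParent {c}) (nextLevel-parent ss)))
    where
    inParent : ∀ {c} → Any (λ s → vertices c ⊆ vertices s) ss → Nonempty (vertices c) →
               Any (vertices c ⊆_) (nonemptyVertices ss)
    inParent a (x , x∈c) = Any-filter-nonempty (λ c⊆q → x , c⊆q x∈c) (AnyP.map⁺ a)

  childrenIn-nonempty-⊆ : ∀ {p} {qs : List (Subset m)} → All (_⊆ p) qs →
                          childrenIn (filter nonempty? qs) p ≡ filter nonempty? qs
  childrenIn-nonempty-⊆ {p} qs⊆p = filter-all (_⊆? p) (AllP.filter⁺ nonempty? qs⊆p)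

  childrenIn-nonempty-disjoint : ∀ {p} {qs : List (Subset m)} → All (Disjoint p) qs →
                                 childrenIn (filter nonempty? qs) p ≡ []
  childrenIn-nonempty-disjoint {p} ds = filter-none (_⊆? p) (filter-nonempty⁺ (All.map ⊈p ds))
    where
    ⊈p : ∀ {q} → Disjoint p q → Nonempty q → ¬ (q ⊆ p)
    ⊈p d (_ , x∈q) q⊆p = Disjoint⇒∉ d (q⊆p x∈q) x∈q

  nextLevel-children : ∀ (ss : List (Tree (Subset m))) → AllPairs (Disjoint on vertices) ss →
    All (λ s → childrenIn (nonemptyVertices (nextLevel ss)) (vertices s)
             ≡ nonemptyVertices (subtrees s)) ss
  nextLevel-children []       []       = []
  nextLevel-children (s ∷ ss) (d ∷ ds) =
    own ∷ All.zipWith (λ {s′} → other {s′}) (d , nextLevel-children ss ds)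
    where
    open ≡-Reasoning
    next = nonemptyVertices (nextLevel ss)
    split : ∀ p → childrenIn (nonemptyVertices (nextLevel (s ∷ ss))) p
                ≡ childrenIn (nonemptyVertices (subtrees s)) p ++ childrenIn next p
    split p = begin
      filter (_⊆? p) (filter nonempty? (map vertices (subtrees s ++ nextLevel ss)))
        ≡⟨ cong (filter (_⊆? p) ∘ filter nonempty?) (map-++ vertices (subtrees s) (nextLevel ss)) ⟩
      filter (_⊆? p) (filter nonempty? (map vertices (subtrees s) ++ map vertices (nextLevel ss)))
        ≡⟨ cong (filter (_⊆? p)) (filter-++ nonempty? (map vertices (subtrees s)) _) ⟩
      filter (_⊆? p) (nonemptyVertices (subtrees s) ++ next)
        ≡⟨ filter-++ (_⊆? p) (nonemptyVertices (subtrees s)) next ⟩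
      childrenIn (nonemptyVertices (subtrees s)) p ++ childrenIn next p ∎
    cousins : All (Disjoint (vertices s)) (map vertices (nextLevel ss))
    cousins = AllP.map⁺ (All-nextLevel (All.map (λ {s′} → subtrees-Disjointʳ {s = s′}) d))
    own : childrenIn (nonemptyVertices (nextLevel (s ∷ ss))) (vertices s)
        ≡ nonemptyVertices (subtrees s)
    own = begin
      childrenIn (nonemptyVertices (nextLevel (s ∷ ss))) (vertices s)
        ≡⟨ split (vertices s) ⟩
      childrenIn (nonemptyVertices (subtrees s)) (vertices s) ++ childrenIn next (vertices s)
        ≡⟨ cong₂ _++_ (childrenIn-nonempty-⊆ (AllP.map⁺ {f = vertices} (vertices-subtrees⊆ s)))
                      (childrenIn-nonempty-disjoint cousins) ⟩
      nonemptyVertices (subtrees s) ++ []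
        ≡⟨ ++-identityʳ _ ⟩
      nonemptyVertices (subtrees s) ∎
    other : ∀ {s′} → Disjoint (vertices s) (vertices s′) ×
            childrenIn next (vertices s′) ≡ nonemptyVertices (subtrees s′) →
            childrenIn (nonemptyVertices (nextLevel (s ∷ ss))) (vertices s′)
              ≡ nonemptyVertices (subtrees s′)
    other {s′} (d′ , eq) =
      trans (split (vertices s′)) (cong₂ _++_ (childrenIn-nonempty-disjoint nephews) eq)
      where
      nephews : All (Disjoint (vertices s′)) (map vertices (subtrees s))
      nephews = AllP.map⁺ (subtrees-Disjointʳ {s = s} (Disjoint-sym d′))

  ⋃⊆⋃-filter-nonempty : ∀ (ps : List (Subset m)) → ⋃ ps ⊆ ⋃ (filter nonempty? ps)
  ⋃⊆⋃-filter-nonempty []       x∈ = x∈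
  ⋃⊆⋃-filter-nonempty (p ∷ ps) x∈ with nonempty? p | x∈p∪q⁻ p (⋃ ps) x∈
  ... | yes _  | inj₁ x∈p  = p⊆p∪q _ x∈p
  ... | yes _  | inj₂ x∈ps = q⊆p∪q p _ (⋃⊆⋃-filter-nonempty ps x∈ps)
  ... | no ¬ne | inj₁ x∈p  = ⊥-elim (¬ne (_ , x∈p))
  ... | no _   | inj₂ x∈ps = ⋃⊆⋃-filter-nonempty ps x∈ps

  ∣vertices─children∣≤∣bag∣ : ∀ χ ts → ∣ vertices (node χ ts) ─ ⋃ (nonemptyVertices ts) ∣ ≤ ∣ χ ∣
  ∣vertices─children∣≤∣bag∣ χ ts = p⊆q⇒∣p∣≤∣q∣ ⊆χ
    where
    ⊆χ : vertices (node χ ts) ─ ⋃ (nonemptyVertices ts) ⊆ χ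
    ⊆χ {x} x∈ with x∈p∪q⁻ χ _ (subst (x ∈_) (vertices-node χ ts) (p─q⊆p _ _ x∈))
    ... | inj₁ x∈χ  = x∈χ
    ... | inj₂ x∈ts = ⊥-elim (x∈p─q⇒x∉q _ _ x∈ (⋃⊆⋃-filter-nonempty (map vertices ts) x∈ts))

  length-nonemptyVertices : ∀ ts → length (nonemptyVertices ts) ≤ length ts
  length-nonemptyVertices ts =
    ℕP.≤-trans (length-filter nonempty? (map vertices ts)) (ℕP.≤-reflexive (length-map vertices ts))

module _ (G : Graph) (ω : ℤ) where

  node-setWidth : ∀ {top} s → NodesWidth≤ G ω top s →
                  SetWidth≤ G ω (nonemptyVertices (subtrees s)) top (vertices s)
  node-setWidth (node χ ts) (cut , tor , _) = cut , ℤP.≤-trans (ℤ.+≤+ tor≤) tor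
    where
    tor≤ = ℕP.+-monoˡ-≤ _ (ℕP.+-mono-≤ (∣vertices─children∣≤∣bag∣ χ ts) (length-nonemptyVertices ts))

  level-width : ∀ {t} → NodesWidth≤ G ω true t → ∀ j → All (NodesWidth≤ G ω (j ≡ᵇ 0)) (level t j)
  level-width w zero    = w ∷ []
  level-width w (suc j) = All-nextLevel (All.map (λ {s} → subtrees-width G ω s) (level-width w j))

  treecut⇒derivation : 1 ≤ n G → ∀ d → HasTreecutDecomposition G ω d → HasDerivation G ω d
  treecut⇒derivation n≥1 d (T , (disj , cover) , w , height≤d) =
    D , width , +a≤d⇒+[1+a]≤d+1 (height T) d height≤d
    where
    K = height T

    Q : ℕ → List (Subset (n G))
    Q j = nonemptyVertices (level T j)

    Q-width : ∀ j → All (λ p → SetWidth≤ G ω (childrenIn (Q (suc j)) p) (j ≡ᵇ 0) p) (Q j)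
    Q-width j = AllP.filter⁺ nonempty? (AllP.map⁺ {f = vertices} (All.zipWith node-width
                  (level-width w j , nextLevel-children (level T j) (proj₁ (level-disjoint disj j)))))
      where
      node-width : ∀ {s} → NodesWidth≤ G ω (j ≡ᵇ 0) s ×
                   childrenIn (Q (suc j)) (vertices s) ≡ nonemptyVertices (subtrees s) →
                   SetWidth≤ G ω (childrenIn (Q (suc j)) (vertices s)) (j ≡ᵇ 0) (vertices s)
      node-width {s} (ws , eq) =
        subst (λ cs → SetWidth≤ G ω cs (j ≡ᵇ 0) (vertices s)) (sym eq) (node-setWidth s ws)

    nonempty-root : Nonempty (vertices T)
    nonempty-root = fromℕ< n≥1 , subst (fromℕ< n≥1 ∈_) (sym cover) ∈⊤

    P : Fin (suc K) → List (Subset (n G))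
    P i = Q (K ∸ toℕ i)

    D : Derivation G
    D = record
      { k       = K
      ; P       = P
      ; weak    = λ i → AllP.all-filter nonempty? (map vertices (level T (K ∸ toℕ i)))
                      , AllPairsP.filter⁺ nonempty?
                          (AllPairsP.map⁺ (proj₁ (level-disjoint disj (K ∸ toℕ i))))
      ; first   = cong (filter nonempty? ∘ map vertices) (level-height≡[] T)
      ; last    = trans (cong Q (∸-fromℕ K))
                        (trans (filter-accept nonempty? nonempty-root) (cong [_] cover))
      ; refines = λ i → subst (λ j → Refines (Q j) (P (suc i))) (sym (∸-inject₁ i))
                              (nextLevel-refines (level T (K ∸ toℕ (suc i))))
      }

    width : Derivation.Width≤ D ω
    width zero    = subst (All _) (sym (Derivation.first D)) []
    width (suc i) = subst₂ (λ j b → All (λ p → SetWidth≤ G ω (childrenIn (Q j) p) b p) (P (suc i)))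
                           (sym (∸-inject₁ i)) (sym (isLast-∸ (suc i))) (Q-width (K ∸ toℕ (suc i)))

mainTheorem4 : (G : Graph) → 1 ≤ n G → (ω d : ℤ) →
    HasTreecutDecomposition G ω d ⇔ HasDerivation G ω d
mainTheorem4 G n≥1 ω d = mk⇔ (treecut⇒derivation G ω n≥1 d) (derivation⇒treecut G ω d)
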